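{- For any $0\le\epsilon\le1$ and any integer $n\ge1$, any $(1+\epsilon)$-spanner on the uniform line metric with $n$ points and hop-diameter at most $2$ contains at least $\frac18 n\log n$ edges.
   Context: The uniform line metric on $n$ points is $\{1,\dots,n\}$ with distance $|a-b|$. A $(1+\epsilon)$-spanner with hop-diameter at most $k$ is a graph $H$ on these points with edges weighted $|a-b|$ such that every pair $a,b$ is joined by a path in $H$ with at most $k$ edges and weight at most $(1+\epsilon)|a-b|$. Logarithms are base $2$.
   Formalization: The parameter ε takes only rational values. -}

module Defs where

open import Data.Nat using (ℕ; zero; suc; _+_; _≤_; _<_; ∣_-_∣)
open import Data.Integer using (+_)
open import Data.Rational as ℚ using (ℚ; _/_; 1ℚ)
open import Data.Product using (_×_; _,_; Σ-syntax; ∃-syntax)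
open import Data.Sum using (_⊎_)
open import Data.List using (List)
open import Data.List.Membership.Propositional using (_∈_)
open import Data.List.Relation.Unary.All using (All)
open import Data.List.Relation.Unary.Unique.Propositional using (Unique)

-- A graph H on the points {1,…,n} of the uniform line metric, given by
-- its list of edges: each edge {u,v} is stored once as the pair (u , v)
-- with 1 ≤ u < v ≤ n, and no edge is listed twice.
-- The number of edges of H is the length of this list.
WellFormedGraph : ℕ → List (ℕ × ℕ) → Set
WellFormedGraph n E =
  All (λ e → (1 ≤ Data.Product.proj₁ e) × (Data.Product.proj₁ e < Data.Product.proj₂ e) × (Data.Product.proj₂ e ≤ n)) E
  × Unique E

Adj : List (ℕ × ℕ) → ℕ → ℕ → Set
Adj E u v = ((u , v) ∈ E) ⊎ ((v , u) ∈ E)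

data Walk (E : List (ℕ × ℕ)) : ℕ → ℕ → ℕ → ℕ → Set where
  here : ∀ {a} → Walk E a a 0 0
  step : ∀ {a c b h w} → Adj E a c → Walk E c b h w →
         Walk E a b (suc h) (∣ a - c ∣ + w)

toℚ : ℕ → ℚ
toℚ m = + m / 1

IsSpanner : ℕ → ℚ → ℕ → List (ℕ × ℕ) → Set
IsSpanner n ε k E =
  ∀ a b → 1 ≤ a → a ≤ n → 1 ≤ b → b ≤ n →
  ∃[ h ] ∃[ w ] (Walk E a b h w × h ≤ k ×
                 (toℚ w ℚ.≤ ((1ℚ ℚ.+ ε) ℚ.* toℚ ∣ a - b ∣)))

{-# OPTIONS --safe #-}
-- Split a block of s consecutive points into halves of sizes h = ⌊s/2⌋ and h′ = ⌈s/2⌉.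
-- A 2-hop path of stretch at most 2 between one of the last ⌈h/2⌉ points of the left half
-- and one of the first ⌈h/2⌉ points of the right half has its middle vertex inside the
-- block, which forces at least ⌈h/2⌉ edges between the halves. So the number T(s) of
-- edges inside a block satisfies T(s) ≥ T(h) + T(h′) + ⌈h/2⌉, and s^s ≤ 2^(8 T(s))
-- follows by induction from s^s ≤ 2^(2h+h′) h^h h′^h′ and 2h + h′ ≤ 8⌈h/2⌉.
module Submission where

open import Defs
open import Data.Nat
open import Data.Nat.Properties
open import Data.Nat.Induction using (<-rec)
open import Data.Nat.ListAction using (sum)
open import Data.Nat.Tactic.RingSolver using (solve; solve-∀)
import Data.Integer as ℤ
import Data.Integer.Properties as ℤ
open import Data.Rational as ℚ using (ℚ; 0ℚ; 1ℚ; mkℚ)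
import Data.Rational.Properties as ℚ
import Data.Rational.Unnormalised as ℚᵘ
import Data.Rational.Unnormalised.Properties as ℚᵘ
open import Data.Nat.Coprimality using (1-coprimeTo) renaming (sym to coprime-sym)
open import Data.Product using (_×_; _,_; proj₁; proj₂; ∃-syntax)
open import Data.Sum using (_⊎_; inj₁; inj₂; [_,_]′)
open import Data.Empty using (⊥-elim)
open import Data.List using (List; []; _∷_; map; length)
open import Data.List.Membership.Propositional using (_∈_; lose)
import Data.List.Relation.Unary.All as All
open import Data.List.Relation.Unary.Any using (Any; here; there; any?)
open import Function using (_∘_; id)
open import Relation.Nullary using (yes; no; ¬?)
open import Relation.Nullary.Decidable using (decidable-stable; _×-dec_)
open import Relation.Unary using (Pred; Decidable)
open import Relation.Binary.PropositionalEquality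
open import Algebra.Properties.CommutativeSemigroup +-commutativeSemigroup using (interchange)
open import Algebra.Properties.CommutativeSemigroup *-commutativeSemigroup
  using () renaming (interchange to *-interchange)
open ≤-Reasoning

toℚ≡mkℚ : ∀ m → toℚ m ≡ mkℚ (ℤ.+ m) 0 (coprime-sym (1-coprimeTo m))
toℚ≡mkℚ m = ℚ.normalize-coprime (coprime-sym (1-coprimeTo m))

≤[1+ε]*⇒≤2* : ∀ {ε w D} → ε ℚ.≤ 1ℚ → toℚ w ℚ.≤ (1ℚ ℚ.+ ε) ℚ.* toℚ D → w ≤ 2 * D
≤[1+ε]*⇒≤2* {ε} {w} {D} ε≤1 w≤[1+ε]D =
  fromᵘ (ℚᵘ.≤-respʳ-≃ (ℚ.toℚᵘ-homo-* (1ℚ ℚ.+ 1ℚ) (toℚ D)) (ℚ.toℚᵘ-mono-≤ w≤2D))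
  where
  w≤2D : toℚ w ℚ.≤ (1ℚ ℚ.+ 1ℚ) ℚ.* toℚ D
  w≤2D = ℚ.≤-trans w≤[1+ε]D
           (subst (λ q → (1ℚ ℚ.+ ε) ℚ.* q ℚ.≤ (1ℚ ℚ.+ 1ℚ) ℚ.* q) (sym (toℚ≡mkℚ D))
             (ℚ.*-monoʳ-≤-nonNeg (mkℚ (ℤ.+ D) 0 _) (ℚ.+-monoʳ-≤ 1ℚ ε≤1)))
  fromᵘ : ℚ.toℚᵘ (toℚ w) ℚᵘ.≤ ℚ.toℚᵘ (1ℚ ℚ.+ 1ℚ) ℚᵘ.* ℚ.toℚᵘ (toℚ D) → w ≤ 2 * D
  fromᵘ rewrite toℚ≡mkℚ w | toℚ≡mkℚ D = λ where
    (ℚᵘ.*≤* w*1≤2D*1) → ℤ.drop‿+≤+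
      (subst₂ ℤ._≤_ (ℤ.*-identityʳ (ℤ.+ w)) (trans (ℤ.*-identityʳ _) (sym (ℤ.pos-* 2 D))) w*1≤2D*1)

-- The middle vertex c of a 2-hop path of stretch at most 2 from a to b lies within
-- (b - a)/2 of the segment [a, b].
detour-bounds : ∀ {a b c} → a ≤ b → ∣ a - c ∣ + ∣ c - b ∣ ≤ 2 * ∣ a - b ∣ →
                3 * a ≤ 2 * c + b × 2 * c + a ≤ 3 * b
detour-bounds {a} {b} {c} a≤b detour with m≤n⇒∃[o]m+o≡n a≤b
... | k , refl = lower , upper
  where
  P Q : ℕ
  P = ∣ a - c ∣
  Q = ∣ c - (a + k) ∣
  P+Q≤2k : P + Q ≤ 2 * k
  P+Q≤2k = subst (λ t → P + Q ≤ 2 * t) (∣m-m+n∣≡n a k) detour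
  x≤∣y-x∣+y : ∀ x y → x ≤ ∣ y - x ∣ + y
  x≤∣y-x∣+y x y = subst (λ t → x ≤ t + y) (∣-∣-comm x y) (m≤∣m-n∣+n x y)
  regroup : ∀ p q x y z → p + x + (q + y) + z ≡ p + q + (x + y + z)
  regroup = solve-∀
  lower : 3 * a ≤ 2 * c + (a + k)
  lower = +-cancelʳ-≤ k _ _ (begin
    3 * a + k               ≡⟨ solve (a ∷ k ∷ []) ⟩
    a + (a + k) + a         ≤⟨ +-monoˡ-≤ a (+-mono-≤ (m≤∣m-n∣+n a c) (x≤∣y-x∣+y (a + k) c)) ⟩
    P + c + (Q + c) + a     ≡⟨ regroup P Q c c a ⟩
    P + Q + (c + c + a)     ≤⟨ +-monoˡ-≤ (c + c + a) P+Q≤2k ⟩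
    2 * k + (c + c + a)     ≡⟨ solve (k ∷ c ∷ a ∷ []) ⟩
    2 * c + (a + k) + k     ∎)
  upper : 2 * c + a ≤ 3 * (a + k)
  upper = begin
    2 * c + a                 ≡⟨ solve (c ∷ a ∷ []) ⟩
    c + c + a                 ≤⟨ +-monoˡ-≤ a (+-mono-≤ (x≤∣y-x∣+y c a) (m≤∣m-n∣+n c (a + k))) ⟩
    P + a + (Q + (a + k)) + a ≡⟨ regroup P Q a (a + k) a ⟩
    P + Q + (a + (a + k) + a) ≤⟨ +-monoˡ-≤ (a + (a + k) + a) P+Q≤2k ⟩
    2 * k + (a + (a + k) + a) ≡⟨ solve (k ∷ a ∷ []) ⟩
    3 * (a + k)               ∎

χ< : ℕ → ℕ → ℕ
χ< zero    _       = 0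
χ< (suc b) zero    = 1
χ< (suc b) (suc z) = χ< b z

χ<-≤1 : ∀ b z → χ< b z ≤ 1
χ<-≤1 zero    _       = z≤n
χ<-≤1 (suc b) zero    = ≤-refl
χ<-≤1 (suc b) (suc z) = χ<-≤1 b z

χ<-mono : ∀ {b b′} z → b ≤ b′ → χ< b z ≤ χ< b′ z
χ<-mono _       z≤n        = z≤n
χ<-mono zero    (s≤s b≤b′) = ≤-refl
χ<-mono (suc z) (s≤s b≤b′) = χ<-mono z b≤b′

χ<-inside : ∀ {b z} → z < b → χ< b z ≡ 1
χ<-inside {suc b} {zero}  _         = refl
χ<-inside {suc b} {suc z} (s≤s z<b) = χ<-inside z<b

χ<-outside : ∀ {b z} → b ≤ z → χ< b z ≡ 0
χ<-outside {zero}  _         = refl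
χ<-outside {suc b} (s≤s b≤z) = χ<-outside b≤z

-- The indicator of [lo, hi), as a difference of indicators of initial segments so that
-- splitting [lo, hi) at m becomes a telescoping identity.
χ : ℕ → ℕ → ℕ → ℕ
χ lo hi z = χ< hi z ∸ χ< lo z

χ-≤1 : ∀ lo hi z → χ lo hi z ≤ 1
χ-≤1 lo hi z = ≤-trans (m∸n≤m (χ< hi z) (χ< lo z)) (χ<-≤1 hi z)

χ-inside : ∀ {lo hi z} → lo ≤ z → z < hi → 1 ≤ χ lo hi z
χ-inside lo≤z z<hi rewrite χ<-inside z<hi | χ<-outside lo≤z = ≤-refl

χ-mono : ∀ {lo hi lo′ hi′} z → lo ≤ lo′ → hi′ ≤ hi → χ lo′ hi′ z ≤ χ lo hi z
χ-mono z lo≤lo′ hi′≤hi = ∸-mono (χ<-mono z hi′≤hi) (χ<-mono z lo≤lo′)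

χ-split : ∀ {lo m hi} z → lo ≤ m → m ≤ hi → χ lo hi z ≡ χ lo m z + χ m hi z
χ-split {lo} {m} {hi} z lo≤m m≤hi = begin-equality
  χ< hi z ∸ χ< lo z                       ≡⟨ cong (_∸ χ< lo z) (m∸n+n≡m (χ<-mono z m≤hi)) ⟨
  (χ< hi z ∸ χ< m z) + χ< m z ∸ χ< lo z   ≡⟨ +-∸-assoc (χ< hi z ∸ χ< m z) (χ<-mono z lo≤m) ⟩
  (χ< hi z ∸ χ< m z) + (χ< m z ∸ χ< lo z) ≡⟨ +-comm (χ< hi z ∸ χ< m z) _ ⟩
  χ lo m z + χ m hi z                     ∎

module _ {A : Set} where

  sum-map-+ : ∀ (f g : A → ℕ) xs → sum (map (λ x → f x + g x) xs) ≡ sum (map f xs) + sum (map g xs)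
  sum-map-+ f g []       = refl
  sum-map-+ f g (x ∷ xs) = begin-equality
    f x + g x + sum (map (λ x → f x + g x) xs)     ≡⟨ cong ((f x + g x) +_) (sum-map-+ f g xs) ⟩
    f x + g x + (sum (map f xs) + sum (map g xs))  ≡⟨ interchange (f x) (g x) _ _ ⟩
    f x + sum (map f xs) + (g x + sum (map g xs))  ∎

  sum-map-mono : ∀ {f g : A → ℕ} xs → (∀ x → f x ≤ g x) → sum (map f xs) ≤ sum (map g xs)
  sum-map-mono []       f≤g = z≤n
  sum-map-mono (x ∷ xs) f≤g = +-mono-≤ (f≤g x) (sum-map-mono xs f≤g)

  sum-map-≤length : ∀ {f : A → ℕ} xs → (∀ x → f x ≤ 1) → sum (map f xs) ≤ length xs
  sum-map-≤length []       f≤1 = z≤n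
  sum-map-≤length (x ∷ xs) f≤1 = +-mono-≤ (f≤1 x) (sum-map-≤length xs f≤1)

  any⇒1≤sum-map : ∀ {P : A → Set} {f : A → ℕ} {xs} → (∀ {x} → P x → 1 ≤ f x) → Any P xs →
                  1 ≤ sum (map f xs)
  any⇒1≤sum-map         P⇒1≤f (here px)   = ≤-trans (P⇒1≤f px) (m≤m+n _ _)
  any⇒1≤sum-map {f = f} P⇒1≤f (there pxs) = ≤-trans (any⇒1≤sum-map P⇒1≤f pxs) (m≤n+m _ (f _))

  count-keys : ∀ (key w : A → ℕ) lo k xs → (∀ {i} → i < k → Any (λ x → key x ≡ lo + i × 1 ≤ w x) xs) →
               k ≤ sum (map (λ x → χ lo (lo + k) (key x) * w x) xs)
  count-keys key w lo zero    xs hit = z≤n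
  count-keys key w lo (suc k) xs hit = begin
    suc k                                  ≡⟨ +-comm 1 k ⟩
    k + 1                                  ≤⟨ +-mono-≤ (count-keys key w lo k xs (hit ∘ m<n⇒m<1+n))
                                                       (any⇒1≤sum-map last-hit (hit ≤-refl)) ⟩
    sum (map left xs) + sum (map right xs) ≡⟨ sum-map-+ left right xs ⟨
    sum (map (λ x → left x + right x) xs)  ≤⟨ sum-map-mono xs (≤-reflexive ∘ split) ⟩
    sum (map (λ x → χ lo (lo + suc k) (key x) * w x) xs) ∎
    where
    left right : A → ℕ
    left x = χ lo (lo + k) (key x) * w x
    right x = χ (lo + k) (lo + suc k) (key x) * w x
    last-hit : ∀ {x} → key x ≡ lo + k × 1 ≤ w x → 1 ≤ right x
    last-hit (key≡ , 1≤w) rewrite key≡ = *-mono-≤ (χ-inside ≤-refl (+-monoʳ-< lo ≤-refl)) 1≤w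
    split : ∀ x → left x + right x ≡ χ lo (lo + suc k) (key x) * w x
    split x = trans (sym (*-distribʳ-+ (w x) (χ lo (lo + k) (key x)) (χ (lo + k) (lo + suc k) (key x))))
                    (cong (_* w x) (sym (χ-split (key x) (m≤m+n lo k) (+-monoʳ-≤ lo (n≤1+n k)))))

edgesWithin : List (ℕ × ℕ) → ℕ → ℕ → ℕ
edgesWithin E lo hi = sum (map (λ e → χ lo hi (proj₁ e) * χ lo hi (proj₂ e)) E)

edgesAcross : List (ℕ × ℕ) → ℕ → ℕ → ℕ → ℕ
edgesAcross E lo m hi = sum (map (λ e → χ lo m (proj₁ e) * χ m hi (proj₂ e)) E)

edgesWithin≤length : ∀ E lo hi → edgesWithin E lo hi ≤ length E
edgesWithin≤length E lo hi =
  sum-map-≤length E (λ e → *-mono-≤ (χ-≤1 lo hi (proj₁ e)) (χ-≤1 lo hi (proj₂ e)))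

cross-terms : ∀ x₁ x₂ y₁ y₂ → x₁ * y₂ + (x₁ * y₁ + x₂ * y₂) ≤ (x₁ + x₂) * (y₁ + y₂)
cross-terms x₁ x₂ y₁ y₂ = begin
  x₁ * y₂ + (x₁ * y₁ + x₂ * y₂)            ≤⟨ m≤m+n _ (x₂ * y₁) ⟩
  x₁ * y₂ + (x₁ * y₁ + x₂ * y₂) + x₂ * y₁ ≡⟨ solve (x₁ ∷ x₂ ∷ y₁ ∷ y₂ ∷ []) ⟩
  (x₁ + x₂) * (y₁ + y₂)                    ∎

edgesWithin-split : ∀ E {lo m hi} → lo ≤ m → m ≤ hi →
  edgesAcross E lo m hi + (edgesWithin E lo m + edgesWithin E m hi) ≤ edgesWithin E lo hi
edgesWithin-split E {lo} {m} {hi} lo≤m m≤hi = begin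
  sum (map across E) + (sum (map left E) + sum (map right E))
    ≡⟨ cong (sum (map across E) +_) (sum-map-+ left right E) ⟨
  sum (map across E) + sum (map (λ e → left e + right e) E)
    ≡⟨ sum-map-+ across (λ e → left e + right e) E ⟨
  sum (map (λ e → across e + (left e + right e)) E)
    ≤⟨ sum-map-mono E pointwise ⟩
  edgesWithin E lo hi ∎
  where
  across left right : ℕ × ℕ → ℕ
  across e = χ lo m (proj₁ e) * χ m hi (proj₂ e)
  left e   = χ lo m (proj₁ e) * χ lo m (proj₂ e)
  right e  = χ m hi (proj₁ e) * χ m hi (proj₂ e)
  pointwise : ∀ e → across e + (left e + right e) ≤ χ lo hi (proj₁ e) * χ lo hi (proj₂ e)
  pointwise (u , v) rewrite χ-split u lo≤m m≤hi | χ-split v lo≤m m≤hi =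
    cross-terms (χ lo m u) (χ m hi u) (χ lo m v) (χ m hi v)

⌈n/2⌉≤1+⌊n/2⌋ : ∀ n → ⌈ n /2⌉ ≤ suc ⌊ n /2⌋
⌈n/2⌉≤1+⌊n/2⌋ zero          = z≤n
⌈n/2⌉≤1+⌊n/2⌋ (suc zero)    = ≤-refl
⌈n/2⌉≤1+⌊n/2⌋ (suc (suc n)) = s≤s (⌈n/2⌉≤1+⌊n/2⌋ n)

^-distribʳ-* : ∀ m n k → (m * n) ^ k ≡ m ^ k * n ^ k
^-distribʳ-* m n zero    = refl
^-distribʳ-* m n (suc k) = begin-equality
  m * n * (m * n) ^ k         ≡⟨ cong (m * n *_) (^-distribʳ-* m n k) ⟩
  m * n * (m ^ k * n ^ k)     ≡⟨ *-interchange m n (m ^ k) (n ^ k) ⟩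
  m * m ^ k * (n * n ^ k)     ∎

^-split : ∀ {s p q} h h′ → s ≤ p * h → s ≤ q * h′ →
          s ^ (h + h′) ≤ p ^ h * q ^ h′ * (h ^ h * h′ ^ h′)
^-split {s} {p} {q} h h′ s≤ph s≤qh′ = begin
  s ^ (h + h′)                        ≡⟨ ^-distribˡ-+-* s h h′ ⟩
  s ^ h * s ^ h′                      ≤⟨ *-mono-≤ (^-monoˡ-≤ h s≤ph) (^-monoˡ-≤ h′ s≤qh′) ⟩
  (p * h) ^ h * (q * h′) ^ h′         ≡⟨ cong₂ _*_ (^-distribʳ-* p h h) (^-distribʳ-* q h′ h′) ⟩
  p ^ h * h ^ h * (q ^ h′ * h′ ^ h′)  ≡⟨ *-interchange (p ^ h) (h ^ h) (q ^ h′) (h′ ^ h′) ⟩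
  p ^ h * q ^ h′ * (h ^ h * h′ ^ h′)  ∎

halving-^ : ∀ {h h′} → 1 ≤ h → h ≤ h′ → h′ ≤ suc h →
            (h + h′) ^ (h + h′) ≤ 2 ^ (8 * ⌈ h /2⌉) * (h ^ h * h′ ^ h′)
halving-^ {h} {h′} 1≤h h≤h′ h′≤1+h = begin
  (h + h′) ^ (h + h′)                   ≤⟨ ^-split h h′ s≤4h s≤2h′ ⟩
  4 ^ h * 2 ^ h′ * (h ^ h * h′ ^ h′)    ≡⟨ cong (_* (h ^ h * h′ ^ h′)) 4^h*2^h′≡2^[2h+h′] ⟩
  2 ^ (2 * h + h′) * (h ^ h * h′ ^ h′)  ≤⟨ *-monoˡ-≤ (h ^ h * h′ ^ h′) (^-monoʳ-≤ 2 (≤-trans 2h+h′≤4h 4h≤8⌈h/2⌉)) ⟩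
  2 ^ (8 * ⌈ h /2⌉) * (h ^ h * h′ ^ h′) ∎
  where
  2h+h′≤4h : 2 * h + h′ ≤ 4 * h
  2h+h′≤4h = begin
    2 * h + h′      ≤⟨ +-monoʳ-≤ (2 * h) h′≤1+h ⟩
    2 * h + suc h   ≤⟨ +-monoʳ-≤ (2 * h) (+-monoˡ-≤ h 1≤h) ⟩
    2 * h + (h + h) ≡⟨ solve (h ∷ []) ⟩
    4 * h           ∎
  s≤4h : h + h′ ≤ 4 * h
  s≤4h = ≤-trans (+-monoˡ-≤ h′ (m≤n*m h 2)) 2h+h′≤4h
  s≤2h′ : h + h′ ≤ 2 * h′
  s≤2h′ = ≤-trans (+-monoˡ-≤ h′ h≤h′) (≤-reflexive (cong (h′ +_) (sym (+-identityʳ h′))))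
  4^h*2^h′≡2^[2h+h′] : 4 ^ h * 2 ^ h′ ≡ 2 ^ (2 * h + h′)
  4^h*2^h′≡2^[2h+h′] = trans (cong (_* 2 ^ h′) (^-*-assoc 2 2 h)) (sym (^-distribˡ-+-* 2 (2 * h) h′))
  double : ∀ x → 4 * (x + x) ≡ 8 * x
  double = solve-∀
  4h≤8⌈h/2⌉ : 4 * h ≤ 8 * ⌈ h /2⌉
  4h≤8⌈h/2⌉ = begin
    4 * h                       ≡⟨ cong (4 *_) (⌊n/2⌋+⌈n/2⌉≡n h) ⟨
    4 * (⌊ h /2⌋ + ⌈ h /2⌉)     ≤⟨ *-monoʳ-≤ 4 (+-monoˡ-≤ ⌈ h /2⌉ (⌊n/2⌋≤⌈n/2⌉ h)) ⟩
    4 * (⌈ h /2⌉ + ⌈ h /2⌉)     ≡⟨ double ⌈ h /2⌉ ⟩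
    8 * ⌈ h /2⌉                 ∎

^-8*-+ : ∀ x y → 2 ^ (8 * x) * 2 ^ (8 * y) ≡ 2 ^ (8 * (x + y))
^-8*-+ x y = trans (sym (^-distribˡ-+-* 2 (8 * x) (8 * y))) (cong (2 ^_) (sym (*-distribˡ-+ 8 x y)))

walk≤2-cases : ∀ {E a b h w} → Walk E a b h w → h ≤ 2 →
  a ≡ b ⊎ Adj E a b ⊎ ∃[ c ] (Adj E a c × Adj E c b × w ≡ ∣ a - c ∣ + ∣ c - b ∣)
walk≤2-cases here                                     _ = inj₁ refl
walk≤2-cases (step ab here)                           _ = inj₂ (inj₁ ab)
walk≤2-cases {a = a} (step {c = c} ac (step cb here)) _ =
  inj₂ (inj₂ (c , ac , cb , cong (∣ a - c ∣ +_) (+-identityʳ _)))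
walk≤2-cases (step _ (step _ (step _ _)))             (s≤s (s≤s ()))

row-or-column : ∀ {p q} {P : Pred ℕ p} {Q : Pred ℕ q} {k l} → Decidable P →
                (∀ {i j} → i < k → j < l → P i ⊎ Q j) →
                (∀ {i} → i < k → P i) ⊎ (∀ {j} → j < l → Q j)
row-or-column {P = P} {k = k} P? cover with anyUpTo? (¬? ∘ P?) k
... | yes (i , i<k , ¬Pi) = inj₂ λ j<l → [ ⊥-elim ∘ ¬Pi , id ]′ (cover i<k j<l)
... | no ∄¬P             = inj₁ λ {i} i<k → decidable-stable (P? i) (λ ¬Pi → ∄¬P (i , i<k , ¬Pi))

module _ {ε : ℚ} {n : ℕ} {E : List (ℕ × ℕ)} (ε≤1 : ε ℚ.≤ 1ℚ)
         (oriented : ∀ {u v} → (u , v) ∈ E → u < v) (spanner : IsSpanner n ε 2 E) where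

  adj⇒∈ : ∀ {u v} → Adj E u v → u < v → (u , v) ∈ E
  adj⇒∈ (inj₁ uv∈E) _   = uv∈E
  adj⇒∈ (inj₂ vu∈E) u<v = ⊥-elim (<-asym u<v (oriented vu∈E))

  two-hop-route : ∀ {a b} → 1 ≤ a → a < b → b ≤ n →
    (a , b) ∈ E ⊎ ∃[ c ] (Adj E a c × Adj E c b × 3 * a ≤ 2 * c + b × 2 * c + a ≤ 3 * b)
  two-hop-route {a} {b} 1≤a a<b b≤n
    with spanner a b 1≤a (≤-trans (<⇒≤ a<b) b≤n) (≤-trans 1≤a (<⇒≤ a<b)) b≤n
  ... | h , w , walk , h≤2 , w≤[1+ε]D with walk≤2-cases walk h≤2
  ...   | inj₁ a≡b                       = ⊥-elim (<-irrefl a≡b a<b)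
  ...   | inj₂ (inj₁ ab)                 = inj₁ (adj⇒∈ ab a<b)
  ...   | inj₂ (inj₂ (c , ac , cb , w≡)) = inj₂ (c , ac , cb , detour-bounds (<⇒≤ a<b)
          (subst (_≤ 2 * ∣ a - b ∣) w≡ (≤[1+ε]*⇒≤2* {D = ∣ a - b ∣} ε≤1 w≤[1+ε]D)))

  -- Test the left points a, …, a+d-1 against the right points a+d, …, a+2d-1. If some left
  -- point has no edge into [a+d, hi), then by detour-bounds the middle vertex of its 2-hop
  -- path to each right point lies in [lo, a+d), giving an edge into every right point;
  -- otherwise every left point has an edge into [a+d, hi).
  across-window : ∀ {lo a d hi} → 1 ≤ lo → hi ≤ suc n → lo + d ≤ suc a → a + 3 * d ≤ suc hi →
                  d ≤ edgesAcross E lo (a + d) hi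
  across-window {d = zero} _ _ _ _ = z≤n
  across-window {lo} {a} {d@(suc d′)} {hi} 1≤lo hi≤1+n lo+d≤1+a a+3d≤1+hi =
    [ via-out , via-in ]′ (row-or-column OutEdge? crossing)
    where
    m : ℕ
    m = a + d
    OutEdge InEdge : ℕ → Set
    OutEdge i = Any (λ e → proj₁ e ≡ a + i × 1 ≤ χ m hi (proj₂ e)) E
    InEdge j  = Any (λ e → proj₂ e ≡ m + j × 1 ≤ χ lo m (proj₁ e)) E
    OutEdge? : Decidable OutEdge
    OutEdge? i = any? (λ e → (proj₁ e ≟ a + i) ×-dec (1 ≤? χ m hi (proj₂ e))) E

    lo≤a : lo ≤ a
    lo≤a = m+n≤o⇒m≤o lo (≤-pred (subst (_≤ suc a) (+-suc lo d′) lo+d≤1+a))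
    m+d≤hi : m + d ≤ hi
    m+d≤hi = ≤-pred (begin
      suc (a + d + d)  ≡⟨ +-comm 1 (a + d + d) ⟩
      a + d + d + 1    ≤⟨ +-monoʳ-≤ (a + d + d) (s≤s z≤n) ⟩
      a + d + d + d    ≡⟨ solve (a ∷ d′ ∷ []) ⟩
      a + 3 * d        ≤⟨ a+3d≤1+hi ⟩
      suc hi           ∎)

    lo≤middle : ∀ {i j c} → j < d → 3 * (a + i) ≤ 2 * c + (m + j) → lo ≤ c
    lo≤middle {i} {j} {c} j<d lower = +-cancelʳ-≤ d lo c (≤-trans lo+d≤1+a (*-cancelˡ-< 2 a (c + d)
      (+-cancelʳ-≤ a _ _ (begin
        suc (2 * a) + a         ≡⟨ solve (a ∷ []) ⟩
        3 * a + 1               ≤⟨ +-monoˡ-≤ 1 (*-monoʳ-≤ 3 (m≤m+n a i)) ⟩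
        3 * (a + i) + 1         ≤⟨ +-monoˡ-≤ 1 lower ⟩
        2 * c + (a + d + j) + 1 ≡⟨ solve (c ∷ a ∷ d′ ∷ j ∷ []) ⟩
        2 * c + (a + d + suc j) ≤⟨ +-monoʳ-≤ (2 * c) (+-monoʳ-≤ m j<d) ⟩
        2 * c + (a + d + d)     ≡⟨ solve (c ∷ a ∷ d′ ∷ []) ⟩
        2 * (c + d) + a         ∎))))

    middle<hi : ∀ {i j c} → j < d → 2 * c + (a + i) ≤ 3 * (m + j) → c < hi
    middle<hi {i} {j} {c} j<d upper = ≤-pred (≤-trans (*-cancelˡ-< 2 (suc c) (a + 3 * d)
      (+-cancelʳ-≤ a _ _ (begin
        suc (2 * suc c) + a     ≡⟨ solve (c ∷ a ∷ []) ⟩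
        2 * c + a + 3           ≤⟨ +-monoˡ-≤ 3 (+-monoʳ-≤ (2 * c) (m≤m+n a i)) ⟩
        2 * c + (a + i) + 3     ≤⟨ +-monoˡ-≤ 3 upper ⟩
        3 * (a + d + j) + 3     ≡⟨ solve (a ∷ d′ ∷ j ∷ []) ⟩
        3 * (a + d + suc j)     ≤⟨ *-monoʳ-≤ 3 (+-monoʳ-≤ m j<d) ⟩
        3 * (a + d + d)         ≡⟨ solve (a ∷ d′ ∷ []) ⟩
        2 * (a + 3 * d) + a     ∎))) a+3d≤1+hi)

    a+i<m : ∀ {i} → i < d → a + i < m
    a+i<m = +-monoʳ-< a
    m+j<hi : ∀ {j} → j < d → m + j < hi
    m+j<hi j<d = <-≤-trans (+-monoʳ-< m j<d) m+d≤hi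

    crossing : ∀ {i j} → i < d → j < d → OutEdge i ⊎ InEdge j
    crossing {i} {j} i<d j<d with two-hop-route (≤-trans 1≤lo (≤-trans lo≤a (m≤m+n a i)))
                                    (<-≤-trans (a+i<m i<d) (m≤m+n m j)) (≤-pred (≤-trans (m+j<hi j<d) hi≤1+n))
    ... | inj₁ e∈E = inj₁ (lose e∈E (refl , χ-inside (m≤m+n m j) (m+j<hi j<d)))
    ... | inj₂ (c , a+i~c , c~m+j , lower , upper) with c <? m
    ...   | yes c<m = inj₂ (lose (adj⇒∈ c~m+j (<-≤-trans c<m (m≤m+n m j)))
                                 (refl , χ-inside (lo≤middle j<d lower) c<m))
    ...   | no  c≮m = inj₁ (lose (adj⇒∈ a+i~c (<-≤-trans (a+i<m i<d) (≮⇒≥ c≮m)))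
                                 (refl , χ-inside (≮⇒≥ c≮m) (middle<hi j<d upper)))

    via-out : (∀ {i} → i < d → OutEdge i) → d ≤ edgesAcross E lo m hi
    via-out out = begin
      d                                                       ≤⟨ count-keys proj₁ (χ m hi ∘ proj₂) a d E out ⟩
      sum (map (λ e → χ a m (proj₁ e) * χ m hi (proj₂ e)) E) ≤⟨ sum-map-mono E (λ e →
        *-monoˡ-≤ (χ m hi (proj₂ e)) (χ-mono {lo} {m} {a} {m} (proj₁ e) lo≤a ≤-refl)) ⟩
      edgesAcross E lo m hi                                   ∎

    via-in : (∀ {j} → j < d → InEdge j) → d ≤ edgesAcross E lo m hi
    via-in into = begin
      d                                                            ≤⟨ count-keys proj₂ (χ lo m ∘ proj₁) m d E into ⟩
      sum (map (λ e → χ m (m + d) (proj₂ e) * χ lo m (proj₁ e)) E) ≤⟨ sum-map-mono E (λ e →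
        ≤-trans (*-monoˡ-≤ (χ lo m (proj₁ e)) (χ-mono {m} {hi} {m} {m + d} (proj₂ e) ≤-refl m+d≤hi))
                (≤-reflexive (*-comm (χ m hi (proj₂ e)) (χ lo m (proj₁ e))))) ⟩
      edgesAcross E lo m hi                                        ∎

  across-balanced : ∀ {lo h hi} → 1 ≤ lo → hi ≤ suc n → lo + h + h ≤ hi →
                    ⌈ h /2⌉ ≤ edgesAcross E lo (lo + h) hi
  across-balanced {lo} {h} {hi} 1≤lo hi≤1+n lo+h+h≤hi =
    subst (λ m → ⌈ h /2⌉ ≤ edgesAcross E lo m hi) a+d≡lo+h
          (across-window 1≤lo hi≤1+n lo+d≤1+a a+3d≤1+hi)
    where
    f d : ℕ
    f = ⌊ h /2⌋
    d = ⌈ h /2⌉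
    f+d≡h : f + d ≡ h
    f+d≡h = ⌊n/2⌋+⌈n/2⌉≡n h
    a+d≡lo+h : lo + f + d ≡ lo + h
    a+d≡lo+h = trans (+-assoc lo f d) (cong (lo +_) f+d≡h)
    lo+d≤1+a : lo + d ≤ suc (lo + f)
    lo+d≤1+a = ≤-trans (+-monoʳ-≤ lo (⌈n/2⌉≤1+⌊n/2⌋ h)) (≤-reflexive (+-suc lo f))
    regroup : ∀ x y z → x + y + 3 * z ≡ x + (y + z) + (z + z)
    regroup = solve-∀
    a+3d≤1+hi : lo + f + 3 * d ≤ suc hi
    a+3d≤1+hi = begin
      lo + f + 3 * d             ≡⟨ regroup lo f d ⟩
      lo + (f + d) + (d + d)     ≤⟨ +-monoʳ-≤ (lo + (f + d)) (+-monoʳ-≤ d (⌈n/2⌉≤1+⌊n/2⌋ h)) ⟩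
      lo + (f + d) + (d + suc f) ≡⟨ cong₂ (λ x y → lo + x + y) f+d≡h
                                          (trans (+-suc d f) (cong suc (trans (+-comm d f) f+d≡h))) ⟩
      lo + h + suc h             ≡⟨ +-suc (lo + h) h ⟩
      suc (lo + h + h)           ≤⟨ s≤s lo+h+h≤hi ⟩
      suc hi                     ∎

  BlockBound : ℕ → Set
  BlockBound s = ∀ {lo hi} → 1 ≤ lo → hi ≤ suc n → lo + s ≡ hi → s ^ s ≤ 2 ^ (8 * edgesWithin E lo hi)

  within-bound-step : ∀ s → (∀ {t} → t < s → BlockBound t) → BlockBound s
  within-bound-step 0 _ {lo} {hi} _ _ _ = m^n>0 2 (8 * edgesWithin E lo hi)
  within-bound-step 1 _ {lo} {hi} _ _ _ = m^n>0 2 (8 * edgesWithin E lo hi)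
  within-bound-step s@(suc (suc t)) rec {lo} 1≤lo hi≤1+n refl = begin
    s ^ s                                     ≡⟨ cong (λ x → x ^ x) h+h′≡s ⟨
    (h + h′) ^ (h + h′)                       ≤⟨ halving-^ (s≤s z≤n) (⌊n/2⌋≤⌈n/2⌉ s) (⌈n/2⌉≤1+⌊n/2⌋ s) ⟩
    2 ^ (8 * ⌈ h /2⌉) * (h ^ h * h′ ^ h′)     ≤⟨ *-mono-≤ (^-monoʳ-≤ 2 (*-monoʳ-≤ 8 across)) (*-mono-≤ left right) ⟩
    2 ^ (8 * X) * (2 ^ (8 * L) * 2 ^ (8 * R)) ≡⟨ cong (2 ^ (8 * X) *_) (^-8*-+ L R) ⟩
    2 ^ (8 * X) * 2 ^ (8 * (L + R))           ≡⟨ ^-8*-+ X (L + R) ⟩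
    2 ^ (8 * (X + (L + R)))                   ≤⟨ ^-monoʳ-≤ 2 (*-monoʳ-≤ 8 (edgesWithin-split E lo≤m m≤hi)) ⟩
    2 ^ (8 * edgesWithin E lo (lo + s))       ∎
    where
    h h′ m : ℕ
    h  = ⌊ s /2⌋
    h′ = ⌈ s /2⌉
    m  = lo + h
    h+h′≡s : h + h′ ≡ s
    h+h′≡s = ⌊n/2⌋+⌈n/2⌉≡n s
    m+h′≡hi : m + h′ ≡ lo + s
    m+h′≡hi = trans (+-assoc lo h h′) (cong (lo +_) h+h′≡s)
    lo≤m : lo ≤ m
    lo≤m = m≤m+n lo h
    m≤hi : m ≤ lo + s
    m≤hi = ≤-trans (m≤m+n m h′) (≤-reflexive m+h′≡hi)
    L R X : ℕ
    L = edgesWithin E lo m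
    R = edgesWithin E m (lo + s)
    X = edgesAcross E lo m (lo + s)
    left : h ^ h ≤ 2 ^ (8 * L)
    left = rec (⌊n/2⌋<n (suc t)) 1≤lo (≤-trans m≤hi hi≤1+n) refl
    right : h′ ^ h′ ≤ 2 ^ (8 * R)
    right = rec (⌈n/2⌉<n t) (≤-trans 1≤lo lo≤m) hi≤1+n m+h′≡hi
    across : ⌈ h /2⌉ ≤ X
    across = across-balanced 1≤lo hi≤1+n
               (≤-trans (+-monoʳ-≤ m (⌊n/2⌋≤⌈n/2⌉ s)) (≤-reflexive m+h′≡hi))

  within-bound : ∀ s → BlockBound s
  within-bound = <-rec BlockBound within-bound-step

lemma4p3 : (ε : ℚ) → 0ℚ ℚ.≤ ε → ε ℚ.≤ 1ℚ → (n : ℕ) → 1 ≤ n →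
    (E : List (ℕ × ℕ)) → WellFormedGraph n E → IsSpanner n ε 2 E →
    n ^ n ≤ 2 ^ (8 * length E)
lemma4p3 ε _ ε≤1 n _ E (inRange , _) spanner = begin
  n ^ n                                ≤⟨ within-bound ε≤1 oriented spanner n (s≤s z≤n) ≤-refl refl ⟩
  2 ^ (8 * edgesWithin E 1 (suc n))    ≤⟨ ^-monoʳ-≤ 2 (*-monoʳ-≤ 8 (edgesWithin≤length E 1 (suc n))) ⟩
  2 ^ (8 * length E)                   ∎
  where
  oriented : ∀ {u v} → (u , v) ∈ E → u < v
  oriented = proj₁ ∘ proj₂ ∘ All.lookup inRange
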